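{- Every formula of $\mathsf L$ that is classically satisfiable is satisfiable in some intuitionistic dynamic model. However, there is a formula of $\mathsf L$ that is satisfiable in some intuitionistic dynamic model but is not classically satisfiable.
   Context: Formulas of $\mathsf L$: $p \mid \bot \mid \wedge \mid \vee \mid \to \mid \bigcirc \mid \Diamond \mid \Box \mid \mathsf U \mid \mathsf R$. An intuitionistic dynamic model is $(W,\preccurlyeq,S,V)$ with $W\ne\varnothing$, $\preccurlyeq$ a partial order, $S\colon W\to W$ with $w\preccurlyeq v\Rightarrow S(w)\preccurlyeq S(v)$, and $V\colon W\to\mathcal P(\mathbb P)$ with $w\preccurlyeq v\Rightarrow V(w)\subseteq V(v)$. Satisfaction: atoms by $V$; $\bot$ false; $\wedge,\vee$ classical; $w\models\bigcirc\varphi$ iff $S(w)\models\varphi$; $w\models\varphi\to\psi$ iff every $v\succcurlyeq w$ with $v\models\varphi$ has $v\models\psi$; $\Diamond,\Box$: some/all $S^k(w)$ ($k\ge0$) satisfy the argument; $\varphi\,\mathsf U\,\psi$: some $k$ with $S^k(w)\models\psi$ and $S^i(w)\models\varphi$ for $i<k$; $\varphi\,\mathsf R\,\psi$: for all $k$, $S^k(w)\models\psi$ or $S^i(w)\models\varphi$ for some $i<k$. A formula is classically satisfiable if it is satisfied at some point of a classical linear temporal logic model $(W,S,V)$ ($S\colon W\to W$, $V\colon W\to\mathcal P(\mathbb P)$) with the same clauses but with $\to$ interpreted as material implication at the current point; equivalently, in an intuitionistic dynamic model whose order $\preccurlyeq$ is the identity. -}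

module Defs where

open import Data.Nat using (ℕ; zero; suc; _<_)
open import Data.Product using (Σ; ∃; _×_; _,_)
open import Data.Sum using (_⊎_)
open import Data.Empty using (⊥)
open import Relation.Binary.PropositionalEquality using (_≡_)

data Form : Set where
  var  : ℕ → Form
  ⊥'   : Form
  _∧'_ : Form → Form → Form
  _∨'_ : Form → Form → Form
  _⇒'_ : Form → Form → Form
  ◯_   : Form → Form
  ◇_   : Form → Form
  □_   : Form → Form
  _U_  : Form → Form → Form
  _R_  : Form → Form → Form

iter : {W : Set} → (W → W) → ℕ → W → W
iter S zero    w = w
iter S (suc k) w = S (iter S k w)

-- Intuitionistic dynamic model (W, ≼, S, V); V w p means p ∈ V(w).
record IDModel : Set₁ where
  field
    W       : Set
    inhabited : W
    _≼_     : W → W → Set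
    ≼-refl  : ∀ {w} → w ≼ w
    ≼-trans : ∀ {u v w} → u ≼ v → v ≼ w → u ≼ w
    ≼-antisym : ∀ {u v} → u ≼ v → v ≼ u → u ≡ v
    S       : W → W
    S-mono  : ∀ {w v} → w ≼ v → S w ≼ S v
    V       : W → ℕ → Set
    V-mono  : ∀ {w v p} → w ≼ v → V w p → V v p

module _ (M : IDModel) where
  open IDModel M

  _⊨_ : W → Form → Set
  w ⊨ var p   = V w p
  w ⊨ ⊥'      = ⊥
  w ⊨ (φ ∧' ψ) = (w ⊨ φ) × (w ⊨ ψ)
  w ⊨ (φ ∨' ψ) = (w ⊨ φ) ⊎ (w ⊨ ψ)
  w ⊨ (φ ⇒' ψ) = ∀ v → w ≼ v → v ⊨ φ → v ⊨ ψ
  w ⊨ (◯ φ)   = S w ⊨ φ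
  w ⊨ (◇ φ)   = Σ ℕ λ k → iter S k w ⊨ φ
  w ⊨ (□ φ)   = ∀ k → iter S k w ⊨ φ
  w ⊨ (φ U ψ) = Σ ℕ λ k → (iter S k w ⊨ ψ) × (∀ i → i < k → iter S i w ⊨ φ)
  w ⊨ (φ R ψ) = ∀ k → (iter S k w ⊨ ψ) ⊎ (Σ ℕ λ i → (i < k) × (iter S i w ⊨ φ))

record CModel : Set₁ where
  field
    W : Set
    S : W → W
    V : W → ℕ → Set

module _ (M : CModel) where
  open CModel M

  _⊨c_ : W → Form → Set
  w ⊨c var p   = V w p
  w ⊨c ⊥'      = ⊥
  w ⊨c (φ ∧' ψ) = (w ⊨c φ) × (w ⊨c ψ)
  w ⊨c (φ ∨' ψ) = (w ⊨c φ) ⊎ (w ⊨c ψ)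
  w ⊨c (φ ⇒' ψ) = w ⊨c φ → w ⊨c ψ
  w ⊨c (◯ φ)   = S w ⊨c φ
  w ⊨c (◇ φ)   = Σ ℕ λ k → iter S k w ⊨c φ
  w ⊨c (□ φ)   = ∀ k → iter S k w ⊨c φ
  w ⊨c (φ U ψ) = Σ ℕ λ k → (iter S k w ⊨c ψ) × (∀ i → i < k → iter S i w ⊨c φ)
  w ⊨c (φ R ψ) = ∀ k → (iter S k w ⊨c ψ) ⊎ (Σ ℕ λ i → (i < k) × (iter S i w ⊨c φ))

IntSat : Form → Set₁
IntSat φ = Σ IDModel λ M → Σ (IDModel.W M) λ w → _⊨_ M w φ

ClassSat : Form → Set₁
ClassSat φ = Σ CModel λ M → Σ (CModel.W M) λ w → _⊨c_ M w φ

-- A classical model is an intuitionistic dynamic model whose order is the identity, and on such a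
-- model the two satisfaction relations coincide. Conversely, ¬◯p ∧ ¬◯¬p is classically of the
-- form ¬A ∧ ¬¬A, but intuitionistically ◯ only looks at the successor S w itself, not at the points
-- above it: if nothing lies above w while S w has p false yet p true at a point above it, then
-- neither ◯p nor ◯¬p holds at w.
module Submission where

open import Defs
open import Data.Product using (Σ; _×_; _,_; map₂)
open import Data.Empty using (⊥)
open import Data.Sum using (map)
open import Relation.Nullary using (¬_)
open import Relation.Binary.PropositionalEquality using (_≡_; refl; trans; cong; subst)

discrete : (M : CModel) → CModel.W M → IDModel
discrete M w₀ = record
  { W = W ; inhabited = w₀
  ; _≼_ = _≡_ ; ≼-refl = refl ; ≼-trans = trans ; ≼-antisym = λ u≡v _ → u≡v
  ; S = S ; S-mono = cong S
  ; V = V ; V-mono = λ u≡v → subst (λ u → V u _) u≡v }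
  where open CModel M

module _ (M : CModel) (w₀ : CModel.W M) where

  private
    D = discrete M w₀
    _⊨ᶜ_ = _⊨c_ M
    _⊨ᵈ_ = _⊨_ D

  mutual
    ⊨ᶜ⇒⊨ᵈ : ∀ φ w → w ⊨ᶜ φ → w ⊨ᵈ φ
    ⊨ᶜ⇒⊨ᵈ (var _)  w h = h
    ⊨ᶜ⇒⊨ᵈ ⊥'       w h = h
    ⊨ᶜ⇒⊨ᵈ (φ ∧' ψ) w (a , b) = ⊨ᶜ⇒⊨ᵈ φ w a , ⊨ᶜ⇒⊨ᵈ ψ w b
    ⊨ᶜ⇒⊨ᵈ (φ ∨' ψ) w h = map (⊨ᶜ⇒⊨ᵈ φ w) (⊨ᶜ⇒⊨ᵈ ψ w) h
    ⊨ᶜ⇒⊨ᵈ (φ ⇒' ψ) w h .w refl a = ⊨ᶜ⇒⊨ᵈ ψ w (h (⊨ᵈ⇒⊨ᶜ φ w a))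
    ⊨ᶜ⇒⊨ᵈ (◯ φ)    w h = ⊨ᶜ⇒⊨ᵈ φ _ h
    ⊨ᶜ⇒⊨ᵈ (◇ φ)    w (k , h) = k , ⊨ᶜ⇒⊨ᵈ φ _ h
    ⊨ᶜ⇒⊨ᵈ (□ φ)    w h k = ⊨ᶜ⇒⊨ᵈ φ _ (h k)
    ⊨ᶜ⇒⊨ᵈ (φ U ψ)  w (k , a , b) = k , ⊨ᶜ⇒⊨ᵈ ψ _ a , λ i i<k → ⊨ᶜ⇒⊨ᵈ φ _ (b i i<k)
    ⊨ᶜ⇒⊨ᵈ (φ R ψ)  w h k = map (⊨ᶜ⇒⊨ᵈ ψ _) (map₂ (map₂ (⊨ᶜ⇒⊨ᵈ φ _))) (h k)

    ⊨ᵈ⇒⊨ᶜ : ∀ φ w → w ⊨ᵈ φ → w ⊨ᶜ φ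
    ⊨ᵈ⇒⊨ᶜ (var _)  w h = h
    ⊨ᵈ⇒⊨ᶜ ⊥'       w h = h
    ⊨ᵈ⇒⊨ᶜ (φ ∧' ψ) w (a , b) = ⊨ᵈ⇒⊨ᶜ φ w a , ⊨ᵈ⇒⊨ᶜ ψ w b
    ⊨ᵈ⇒⊨ᶜ (φ ∨' ψ) w h = map (⊨ᵈ⇒⊨ᶜ φ w) (⊨ᵈ⇒⊨ᶜ ψ w) h
    ⊨ᵈ⇒⊨ᶜ (φ ⇒' ψ) w h a = ⊨ᵈ⇒⊨ᶜ ψ w (h w refl (⊨ᶜ⇒⊨ᵈ φ w a))
    ⊨ᵈ⇒⊨ᶜ (◯ φ)    w h = ⊨ᵈ⇒⊨ᶜ φ _ h
    ⊨ᵈ⇒⊨ᶜ (◇ φ)    w (k , h) = k , ⊨ᵈ⇒⊨ᶜ φ _ h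
    ⊨ᵈ⇒⊨ᶜ (□ φ)    w h k = ⊨ᵈ⇒⊨ᶜ φ _ (h k)
    ⊨ᵈ⇒⊨ᶜ (φ U ψ)  w (k , a , b) = k , ⊨ᵈ⇒⊨ᶜ ψ _ a , λ i i<k → ⊨ᵈ⇒⊨ᶜ φ _ (b i i<k)
    ⊨ᵈ⇒⊨ᶜ (φ R ψ)  w h k = map (⊨ᵈ⇒⊨ᶜ ψ _) (map₂ (map₂ (⊨ᵈ⇒⊨ᶜ φ _))) (h k)

ClassSat⇒IntSat : ∀ φ → ClassSat φ → IntSat φ
ClassSat⇒IntSat φ (M , w , w⊨φ) = discrete M w , w , ⊨ᶜ⇒⊨ᵈ M w φ w w⊨φ

infix 30 ¬'_

¬'_ : Form → Form
¬' φ = φ ⇒' ⊥'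

¬∧¬¬-classically-unsat : ∀ φ → ¬ ClassSat (¬' φ ∧' ¬' ¬' φ)
¬∧¬¬-classically-unsat φ (M , w , ¬φ , ¬¬φ) = ¬¬φ ¬φ

data Point : Set where
  root bottom top : Point

data _⊑_ : Point → Point → Set where
  ⊑-refl     : ∀ {x} → x ⊑ x
  bottom⊑top : bottom ⊑ top

⊑-trans : ∀ {x y z} → x ⊑ y → y ⊑ z → x ⊑ z
⊑-trans ⊑-refl     y⊑z    = y⊑z
⊑-trans bottom⊑top ⊑-refl = bottom⊑top

⊑-antisym : ∀ {x y} → x ⊑ y → y ⊑ x → x ≡ y
⊑-antisym ⊑-refl _ = refl

step : Point → Point
step root   = bottom
step bottom = bottom
step top    = top

step-mono : ∀ {x y} → x ⊑ y → step x ⊑ step y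
step-mono ⊑-refl     = ⊑-refl
step-mono bottom⊑top = bottom⊑top

top-upward : ∀ {x y} → x ⊑ y → x ≡ top → y ≡ top
top-upward ⊑-refl     x≡top = x≡top
top-upward bottom⊑top _     = refl

forkModel : IDModel
forkModel = record
  { W = Point ; inhabited = root
  ; _≼_ = _⊑_ ; ≼-refl = ⊑-refl ; ≼-trans = ⊑-trans ; ≼-antisym = ⊑-antisym
  ; S = step ; S-mono = step-mono
  ; V = λ x _ → x ≡ top ; V-mono = top-upward }

p : Form
p = var 0

root⊨¬◯p∧¬◯¬p : _⊨_ forkModel root (¬' (◯ p) ∧' ¬' (◯ (¬' p)))
root⊨¬◯p∧¬◯¬p = not-◯p , not-◯¬p
  where
  not-◯p : ∀ x → root ⊑ x → _⊨_ forkModel x (◯ p) → ⊥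
  not-◯p .root ⊑-refl ()

  not-◯¬p : ∀ x → root ⊑ x → _⊨_ forkModel x (◯ (¬' p)) → ⊥
  not-◯¬p .root ⊑-refl bottom⊨¬p = bottom⊨¬p top bottom⊑top refl

proposition2p2 : ((φ : Form) → ClassSat φ → IntSat φ)
    × Σ Form (λ φ → IntSat φ × ¬ ClassSat φ)
proposition2p2 =
  ClassSat⇒IntSat ,
  ¬' (◯ p) ∧' ¬' (◯ (¬' p)) ,
  (forkModel , root , root⊨¬◯p∧¬◯¬p) ,
  ¬∧¬¬-classically-unsat (◯ p)
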